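{- For every integer $k\geq 2$, there exists an integer $g(k)$ such that $rc_k(K_{r,r})=3$ for every integer $r\geq g(k)$.
   Context: All graphs are simple, finite and undirected. $K_{r,r}$ denotes the complete bipartite graph with both parts of size $r$. Given an edge-coloring of a graph $G$ (adjacent edges may receive the same color), a path is called rainbow if no two of its edges have the same color. For a $\kappa$-connected graph $G$ and an integer $k$ with $1\leq k\leq \kappa$, the rainbow $k$-connectivity $rc_k(G)$ is the minimum integer $j$ for which there exists an edge-coloring of $G$ with $j$ colors such that any two distinct vertices $u,v$ of $G$ are connected by at least $k$ internally disjoint rainbow $u$–$v$ paths. -}

module Defs where

open import Data.Nat using (ℕ; _+_; _<_)
open import Data.Fin using (Fin; splitAt)
open import Data.Bool using (Bool; true; false)
open import Data.Sum using (_⊎_; inj₁; inj₂)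
open import Data.Product using (_×_; _,_; Σ; ∃; ∃-syntax)
open import Data.List using (List; []; _∷_; _++_; map)
open import Data.List.Relation.Unary.All using (All)
open import Data.List.Relation.Unary.Unique.Propositional using (Unique)
open import Data.List.Membership.Propositional using (_∈_; _∉_)
open import Relation.Binary.PropositionalEquality using (_≡_; _≢_)
open import Relation.Nullary using (¬_)

record Graph : Set₁ where
  field
    n     : ℕ
    Adj   : Fin n → Fin n → Set
    sym   : ∀ {x y} → Adj x y → Adj y x
    irrefl : ∀ {x} → ¬ Adj x x
open Graph public

pairs : {A : Set} → List A → List (A × A)
pairs []            = []
pairs (x ∷ [])      = []
pairs (x ∷ y ∷ xs)  = (x , y) ∷ pairs (y ∷ xs)

-- An edge-colouring of G with (at most) j colours: a colour for each ordered
-- pair, symmetric on edges (values on non-edges are irrelevant).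
record EdgeColouring (G : Graph) (j : ℕ) : Set where
  field
    col    : Fin (n G) → Fin (n G) → Fin j
    colSym : ∀ {x y} → Adj G x y → col x y ≡ col y x
open EdgeColouring public

fullPath : {A : Set} → A → List A → A → List A
fullPath u ws v = u ∷ (ws ++ v ∷ [])

IsRainbowPath : (G : Graph) {j : ℕ} → EdgeColouring G j →
                Fin (n G) → Fin (n G) → List (Fin (n G)) → Set
IsRainbowPath G c u v ws =
  Unique (fullPath u ws v)
  × All (λ e → Adj G (Data.Product.proj₁ e) (Data.Product.proj₂ e)) (pairs (fullPath u ws v))
  × Unique (map (λ e → col c (Data.Product.proj₁ e) (Data.Product.proj₂ e)) (pairs (fullPath u ws v)))

HasKRainbowPaths : (G : Graph) {j : ℕ} → EdgeColouring G j → ℕ →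
                   Fin (n G) → Fin (n G) → Set
HasKRainbowPaths G c k u v =
  Σ (Fin k → List (Fin (n G))) λ P →
      (∀ a → IsRainbowPath G c u v (P a))
    × (∀ a b → a ≢ b → P a ≢ P b)
    × (∀ a b → a ≢ b → ∀ x → x ∈ P a → x ∉ P b)

RainbowKConnected : (G : Graph) {j : ℕ} → EdgeColouring G j → ℕ → Set
RainbowKConnected G c k = ∀ u v → u ≢ v → HasKRainbowPaths G c k u v

RcIs : Graph → ℕ → ℕ → Set
RcIs G k m =
    (∃[ c ] RainbowKConnected G {m} c k)
  × (∀ j → j < m → (c : EdgeColouring G j) → ¬ RainbowKConnected G c k)

side : {r : ℕ} → Fin (r + r) → Bool
side {r} x with splitAt r x
... | inj₁ _ = true
... | inj₂ _ = false

Kbip : ℕ → Graph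
Kbip r = record
  { n = r + r
  ; Adj = λ x y → side {r} x ≢ side {r} y
  ; sym = λ p q → p (Relation.Binary.PropositionalEquality.sym q)
  ; irrefl = λ p → p Relation.Binary.PropositionalEquality.refl
  }

-- Give both sides of K_{r,r} the vertex set ℤ/r and colour the edge between left i and right x
-- by φ(x − i) for a pattern φ : ℤ/r → {0, 1, 2}. Two vertices i, j on the same side are joined
-- through k common neighbours i + t as soon as φ(t) ≠ φ(t − (j − i)) for k values of t. A left
-- vertex i and a right vertex j are joined by their edge and by k − 1 paths i, i + α, j − β, j,
-- which are rainbow when φ takes three distinct values at α, β and γ = α + β − (j − i).
-- Taking φ = 0 on [L, r) and, on [0, L), alternately k ones and k twos (L = 16k²), such t and
-- (α, β, γ) can be written down explicitly once r ≥ 3L; a difference d close to r is handled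
-- by reflecting t ↦ t − d.
-- Conversely, with two colours a rainbow path has at most two edges, while paths between the
-- two sides have odd length, so such a pair is joined by its edge alone.

module Submission where

open import Defs hiding (sym)
open import Data.Nat
open import Data.Nat.Properties
open import Data.Nat.DivMod
open import Data.Nat.Tactic.RingSolver using (solve-∀)
open import Data.Fin using (Fin; zero; suc; toℕ; fromℕ<; _↑ˡ_; _↑ʳ_; splitAt)
open import Data.Fin.Patterns using (0F; 1F; 2F)
open import Data.Fin.Properties
  using (toℕ-fromℕ<; toℕ-injective; toℕ<n; ↑ˡ-injective; ↑ʳ-injective;
         splitAt-↑ˡ; splitAt-↑ʳ; splitAt⁻¹-↑ˡ; splitAt⁻¹-↑ʳ; pigeonhole)
open import Data.Bool using (true; false)
open import Data.Empty using (⊥-elim)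
open import Data.Sum using (inj₁; inj₂)
open import Data.Product using (_,_; ∃-syntax)
open import Data.List using (List; []; _∷_)
open import Data.List.Properties using (∷-injectiveˡ)
open import Data.List.Relation.Unary.All using ([]; _∷_)
open import Data.List.Relation.Unary.AllPairs using ([]; _∷_)
open import Data.List.Relation.Unary.Any using (here; there)
open import Data.List.Membership.Propositional using (_∈_)
open import Algebra.Properties.CommutativeSemigroup +-commutativeSemigroup
  using (x∙yz≈y∙xz; xy∙z≈xz∙y; xy∙z≈x∙zy; x∙yz≈xz∙y)
open import Function.Definitions using (Injective)
open import Relation.Nullary using (¬_; yes; no)
open import Relation.Binary.PropositionalEquality

-- Rainbow paths in an arbitrary graph

module _ (G : Graph) {j : ℕ} (c : EdgeColouring G j) where

  private
    V : Set
    V = Fin (n G)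

    _─_ : V → V → Fin j
    _─_ = col c

  rainbow-edge : ∀ {u v : V} → u ≢ v → Adj G u v → IsRainbowPath G c u v []
  rainbow-edge u≢v uv = ((u≢v ∷ []) ∷ [] ∷ []) , (uv ∷ []) , ([] ∷ [])

  rainbow-path₂ : ∀ {u w v : V} → u ≢ w → u ≢ v → w ≢ v →
                  Adj G u w → Adj G w v → u ─ w ≢ w ─ v →
                  IsRainbowPath G c u v (w ∷ [])
  rainbow-path₂ u≢w u≢v w≢v uw wv c₁≢c₂ =
    ((u≢w ∷ u≢v ∷ []) ∷ (w≢v ∷ []) ∷ [] ∷ []) , (uw ∷ wv ∷ []) , ((c₁≢c₂ ∷ []) ∷ [] ∷ [])

  rainbow-path₃ : ∀ {u w₁ w₂ v : V} →
                  u ≢ w₁ → u ≢ w₂ → u ≢ v → w₁ ≢ w₂ → w₁ ≢ v → w₂ ≢ v →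
                  Adj G u w₁ → Adj G w₁ w₂ → Adj G w₂ v →
                  u ─ w₁ ≢ w₁ ─ w₂ → u ─ w₁ ≢ w₂ ─ v → w₁ ─ w₂ ≢ w₂ ─ v →
                  IsRainbowPath G c u v (w₁ ∷ w₂ ∷ [])
  rainbow-path₃ u≢w₁ u≢w₂ u≢v w₁≢w₂ w₁≢v w₂≢v uw₁ w₁w₂ w₂v c₁≢c₂ c₁≢c₃ c₂≢c₃ =
    ((u≢w₁ ∷ u≢w₂ ∷ u≢v ∷ []) ∷ (w₁≢w₂ ∷ w₁≢v ∷ []) ∷ (w₂≢v ∷ []) ∷ [] ∷ []) ,
    (uw₁ ∷ w₁w₂ ∷ w₂v ∷ []) ,
    ((c₁≢c₂ ∷ c₁≢c₃ ∷ []) ∷ (c₂≢c₃ ∷ []) ∷ [] ∷ [])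

  module _ {u v : V} where

    rainbow-paths-through-one : ∀ {k} (w : Fin k → V) → Injective _≡_ _≡_ w →
                                (∀ a → IsRainbowPath G c u v (w a ∷ [])) →
                                HasKRainbowPaths G c k u v
    rainbow-paths-through-one w w-inj rainbow =
      (λ a → w a ∷ []) , rainbow ,
      (λ a b a≢b eq → a≢b (w-inj (∷-injectiveˡ eq))) ,
      λ { a b a≢b _ (here refl) (here eq) → a≢b (w-inj eq) }

    rainbow-paths-through-two : ∀ {k} (x y : Fin k → V) →
                                Injective _≡_ _≡_ x → Injective _≡_ _≡_ y → (∀ a b → x a ≢ y b) →
                                IsRainbowPath G c u v [] →
                                (∀ a → IsRainbowPath G c u v (x a ∷ y a ∷ [])) →
                                HasKRainbowPaths G c (suc k) u v
    rainbow-paths-through-two {k} x y x-inj y-inj x≢y edge rainbow =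
      P , P-rainbow , P-distinct , P-disjoint
      where
      P : Fin (suc k) → List V
      P zero    = []
      P (suc a) = x a ∷ y a ∷ []

      P-rainbow : ∀ a → IsRainbowPath G c u v (P a)
      P-rainbow zero    = edge
      P-rainbow (suc a) = rainbow a

      P-distinct : ∀ a b → a ≢ b → P a ≢ P b
      P-distinct zero    zero    a≢b _  = a≢b refl
      P-distinct (suc a) (suc b) a≢b eq = a≢b (cong suc (x-inj (∷-injectiveˡ eq)))

      P-disjoint : ∀ a b → a ≢ b → ∀ z → z ∈ P a → ¬ (z ∈ P b)
      P-disjoint (suc a) (suc b) a≢b _ (here refl)         (here eq)         = a≢b (cong suc (x-inj eq))
      P-disjoint (suc a) (suc b) a≢b _ (here refl)         (there (here eq)) = x≢y a b eq
      P-disjoint (suc a) (suc b) a≢b _ (there (here refl)) (here eq)         = x≢y b a (sym eq)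
      P-disjoint (suc a) (suc b) a≢b _ (there (here refl)) (there (here eq)) = a≢b (cong suc (y-inj eq))

-- K_{r,r} and the lower bound

module Bipartite (r : ℕ) where

  left right : Fin r → Fin (r + r)
  left  i = i ↑ˡ r
  right x = r ↑ʳ x

  side-left : ∀ i → side {r} (left i) ≡ true
  side-left i rewrite splitAt-↑ˡ r i r = refl

  side-right : ∀ x → side {r} (right x) ≡ false
  side-right x rewrite splitAt-↑ʳ r r x = refl

  left-adj-right : ∀ i x → Adj (Kbip r) (left i) (right x)
  left-adj-right i x eq with trans (sym (side-left i)) (trans eq (side-right x))
  ... | ()

  right-adj-left : ∀ x i → Adj (Kbip r) (right x) (left i)
  right-adj-left x i = Graph.sym (Kbip r) (left-adj-right i x)

  left≢right : ∀ i x → left i ≢ right x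
  left≢right i x eq = left-adj-right i x (cong side eq)

  right≢left : ∀ x i → right x ≢ left i
  right≢left x i eq = left≢right i x (sym eq)

  left-injective : Injective _≡_ _≡_ left
  left-injective = ↑ˡ-injective r _ _

  right-injective : Injective _≡_ _≡_ right
  right-injective = ↑ʳ-injective r _ _

  data Side : Fin (r + r) → Set where
    isLeft  : ∀ i → Side (left i)
    isRight : ∀ x → Side (right x)

  side-view : ∀ u → Side u
  side-view u with splitAt r u in eq
  ... | inj₁ i = subst Side (splitAt⁻¹-↑ˡ eq) (isLeft i)
  ... | inj₂ x = subst Side (splitAt⁻¹-↑ʳ eq) (isRight x)

three-distinct⇒3≤ : ∀ {j} (a b c : Fin j) → a ≢ b → a ≢ c → b ≢ c → 3 ≤ j
three-distinct⇒3≤ {j} a b c a≢b a≢c b≢c with 3 ≤? j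
... | yes 3≤j = 3≤j
... | no  3≰j with pigeonhole (≰⇒> 3≰j) (λ { 0F → a ; 1F → b ; 2F → c })
...   | 0F , 1F , _ , eq = ⊥-elim (a≢b eq)
...   | 0F , 2F , _ , eq = ⊥-elim (a≢c eq)
...   | 1F , 2F , _ , eq = ⊥-elim (b≢c eq)
...   | suc _ , 1F , s≤s () , _
...   | 2F , 2F , s≤s (s≤s ()) , _

module _ {r j : ℕ} (j<3 : j < 3) (c : EdgeColouring (Kbip r) j) where

  open Bipartite r

  left-right-rainbow⇒edge : ∀ i x ws → IsRainbowPath (Kbip r) c (left i) (right x) ws → ws ≡ []
  left-right-rainbow⇒edge i x [] _ = refl
  left-right-rainbow⇒edge i x (w ∷ []) (_ , (iw ∷ wx ∷ []) , _) with side {r} w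
  ... | true  = ⊥-elim (iw (side-left i))
  ... | false = ⊥-elim (wx (sym (side-right x)))
  left-right-rainbow⇒edge i x (_ ∷ _ ∷ []) (_ , _ , ((c₁≢c₂ ∷ c₁≢c₃ ∷ _) ∷ (c₂≢c₃ ∷ _) ∷ _)) =
    ⊥-elim (<⇒≱ j<3 (three-distinct⇒3≤ _ _ _ c₁≢c₂ c₁≢c₃ c₂≢c₃))
  left-right-rainbow⇒edge i x (_ ∷ _ ∷ _ ∷ _) (_ , _ , ((c₁≢c₂ ∷ c₁≢c₃ ∷ _) ∷ (c₂≢c₃ ∷ _) ∷ _)) =
    ⊥-elim (<⇒≱ j<3 (three-distinct⇒3≤ _ _ _ c₁≢c₂ c₁≢c₃ c₂≢c₃))

  fewer-than-three-colours : ∀ {k} → 2 ≤ k → Fin r → ¬ RainbowKConnected (Kbip r) c k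
  fewer-than-three-colours (s≤s (s≤s _)) i connected
    with P , rainbow , distinct , _ ← connected (left i) (right i) (left≢right i i) =
    distinct 0F 1F (λ ()) (trans (left-right-rainbow⇒edge i i (P 0F) (rainbow 0F))
                                  (sym (left-right-rainbow⇒edge i i (P 1F) (rainbow 1F))))

-- Residues modulo r

module Cyclic (r : ℕ) .{{_ : NonZero r}} where

  infix 4 _≈_
  _≈_ : ℕ → ℕ → Set
  m ≈ n = m % r ≡ n % r

  m+r≈m : ∀ m → m + r ≈ m
  m+r≈m m = [m+n]%n≡m%n m r

  m%r≈m : ∀ m → m % r ≈ m
  m%r≈m m = m%n%n≡m%n m r

  m+[r∸d]+d≈m : ∀ m {d} → d ≤ r → m + (r ∸ d) + d ≈ m
  m+[r∸d]+d≈m m d≤r = trans (cong (_% r) (trans (+-assoc m _ _) (cong (m +_) (m∸n+n≡m d≤r)))) (m+r≈m m)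

  ≈⇒≡ : ∀ {m n} → m < r → n < r → m ≈ n → m ≡ n
  ≈⇒≡ m<r n<r m≈n = trans (sym (m<n⇒m%n≡m m<r)) (trans m≈n (m<n⇒m%n≡m n<r))

  +-congʳ-≈ : ∀ {m m'} n → m ≈ m' → m + n ≈ m' + n
  +-congʳ-≈ {m} {m'} n m≈m' = begin
    (m + n) % r             ≡⟨ %-distribˡ-+ m n r ⟩
    (m % r + n % r) % r     ≡⟨ cong (λ z → (z + n % r) % r) m≈m' ⟩
    (m' % r + n % r) % r    ≡⟨ %-distribˡ-+ m' n r ⟨
    (m' + n) % r            ∎
    where open ≡-Reasoning

  +-congˡ-≈ : ∀ m {n n'} → n ≈ n' → m + n ≈ m + n'
  +-congˡ-≈ m {n} {n'} n≈n' =
    trans (cong (_% r) (+-comm m n)) (trans (+-congʳ-≈ m n≈n') (cong (_% r) (+-comm n' m)))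

  +-cancelʳ-≈ : ∀ {m n} c → m + c ≈ n + c → m ≈ n
  +-cancelʳ-≈ {m} {n} c m+c≈n+c =
    trans (sym (undo m)) (trans (+-congʳ-≈ (r ∸ c % r) m+c≈n+c) (undo n))
    where
    undo : ∀ x → x + c + (r ∸ c % r) ≈ x
    undo x = begin
      (x + c + (r ∸ c % r)) % r        ≡⟨ +-congʳ-≈ (r ∸ c % r) (+-congˡ-≈ x (sym (m%r≈m c))) ⟩
      (x + c % r + (r ∸ c % r)) % r    ≡⟨ cong (_% r) (xy∙z≈xz∙y x (c % r) _) ⟩
      (x + (r ∸ c % r) + c % r) % r    ≡⟨ m+[r∸d]+d≈m x (m%n≤n c r) ⟩
      x % r                            ∎
      where open ≡-Reasoning

  +-cancelˡ-≈ : ∀ c {m n} → c + m ≈ c + n → m ≈ n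
  +-cancelˡ-≈ c {m} {n} c+m≈c+n =
    +-cancelʳ-≈ c (trans (cong (_% r) (+-comm m c)) (trans c+m≈c+n (cong (_% r) (+-comm c n))))

  δ : Fin r → Fin r → ℕ
  δ i x = (toℕ x + (r ∸ toℕ i)) % r

  δ<r : ∀ i x → δ i x < r
  δ<r i x = m%n<n _ r

  δ-spec : ∀ i x → toℕ i + δ i x ≈ toℕ x
  δ-spec i x = begin
    (toℕ i + δ i x) % r                      ≡⟨ +-congˡ-≈ (toℕ i) (m%r≈m _) ⟩
    (toℕ i + (toℕ x + (r ∸ toℕ i))) % r      ≡⟨ cong (_% r) (x+[i+[r∸i]]) ⟩
    (toℕ x + r) % r                          ≡⟨ m+r≈m (toℕ x) ⟩
    toℕ x % r                                ∎
    where
    open ≡-Reasoning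
    x+[i+[r∸i]] : toℕ i + (toℕ x + (r ∸ toℕ i)) ≡ toℕ x + r
    x+[i+[r∸i]] = trans (x∙yz≈y∙xz (toℕ i) (toℕ x) _) (cong (toℕ x +_) (m+[n∸m]≡n (<⇒≤ (toℕ<n i))))

  δ-unique : ∀ {i x t} → t < r → toℕ i + t ≈ toℕ x → δ i x ≡ t
  δ-unique {i} {x} t<r i+t≈x =
    ≈⇒≡ (δ<r i x) t<r (+-cancelˡ-≈ (toℕ i) (trans (δ-spec i x) (sym i+t≈x)))

  δ≢0 : ∀ {i x} → i ≢ x → δ i x ≢ 0
  δ≢0 {i} {x} i≢x δ≡0 = i≢x (toℕ-injective (≈⇒≡ (toℕ<n i) (toℕ<n x) i≈x))
    where
    i≈x : toℕ i ≈ toℕ x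
    i≈x = trans (cong (_% r) (sym (+-identityʳ _)))
                (trans (cong (λ t → (toℕ i + t) % r) (sym δ≡0)) (δ-spec i x))

  infixl 6 _⊕_ _⊖_
  _⊕_ _⊖_ : Fin r → ℕ → Fin r
  i ⊕ t = (toℕ i + t) mod r
  x ⊖ t = x ⊕ (r ∸ t)

  ⊕-spec : ∀ i t → toℕ (i ⊕ t) ≈ toℕ i + t
  ⊕-spec i t = trans (cong (_% r) (toℕ-fromℕ< _)) (m%r≈m _)

  ⊖-spec : ∀ x {t} → t ≤ r → toℕ (x ⊖ t) + t ≈ toℕ x
  ⊖-spec x {t} t≤r = trans (+-congʳ-≈ t (⊕-spec x (r ∸ t))) (m+[r∸d]+d≈m (toℕ x) t≤r)

  δ-⊕ : ∀ i {t} → t < r → δ i (i ⊕ t) ≡ t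
  δ-⊕ i {t} t<r = δ-unique t<r (sym (⊕-spec i t))

  δ-⊖ : ∀ x {t} → t < r → δ (x ⊖ t) x ≡ t
  δ-⊖ x t<r = δ-unique t<r (⊖-spec x (<⇒≤ t<r))

-- The pattern φ

module Pattern (k : ℕ) .{{_ : NonZero k}} where

  M L : ℕ
  M = k + k
  L = 8 * k * M

  k<M : k < M
  k<M = m<m+n k (>-nonZero⁻¹ k)

  instance
    M-nonZero : NonZero M
    M-nonZero = >-nonZero (<-trans (>-nonZero⁻¹ k) k<M)

    L-nonZero : NonZero L
    L-nonZero = m*n≢0 (8 * k) M {{m*n≢0 8 k}}

  φ : ℕ → Fin 3
  φ t with t <? L | k ≤? t % M
  ... | no  _ | _     = 0F
  ... | yes _ | no  _ = 1F
  ... | yes _ | yes _ = 2F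

  φ-outside : ∀ {t} → L ≤ t → φ t ≡ 0F
  φ-outside {t} L≤t with t <? L | k ≤? t % M
  ... | no  _   | _ = refl
  ... | yes t<L | _ = ⊥-elim (<⇒≱ t<L L≤t)

  φ-first-half : ∀ {t} → t < L → t % M < k → φ t ≡ 1F
  φ-first-half {t} t<L t%M<k with t <? L | k ≤? t % M
  ... | no  t≮L | _       = ⊥-elim (t≮L t<L)
  ... | yes _   | no  _   = refl
  ... | yes _   | yes k≤t = ⊥-elim (<⇒≱ t%M<k k≤t)

  φ-second-half : ∀ {t} → t < L → k ≤ t % M → φ t ≡ 2F
  φ-second-half {t} t<L k≤t%M with t <? L | k ≤? t % M
  ... | no  t≮L | _       = ⊥-elim (t≮L t<L)
  ... | yes _   | no  k≰t = ⊥-elim (k≰t k≤t%M)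
  ... | yes _   | yes _   = refl

  block<L : ∀ {a q} → a < M → q < 8 * k → a + q * M < L
  block<L {a} {q} a<M q<8k = <-≤-trans (+-monoˡ-< (q * M) a<M) (*-monoˡ-≤ M q<8k)

  block%M : ∀ {a} q → a < M → (a + q * M) % M ≡ a
  block%M {a} q a<M = trans ([m+kn]%n≡m%n a q M) (m<n⇒m%n≡m a<M)

  φ-block-first : ∀ {a q} → a < k → q < 8 * k → φ (a + q * M) ≡ 1F
  φ-block-first {a} {q} a<k q<8k =
    φ-first-half (block<L a<M q<8k) (subst (_< k) (sym (block%M q a<M)) a<k)
    where a<M = <-trans a<k k<M

  φ-block-second : ∀ {q} → q < 8 * k → φ (k + q * M) ≡ 2F
  φ-block-second {q} q<8k = φ-second-half (block<L k<M q<8k) (≤-reflexive (sym (block%M q k<M)))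

  <k⇒<8k : ∀ {s} → s < k → s < 8 * k
  <k⇒<8k s<k = <-≤-trans s<k (m≤n*m k 8)

  <k⇒7k+<8k : ∀ {s} → s < k → 7 * k + s < 8 * k
  <k⇒7k+<8k {s} s<k = subst (7 * k + s <_) (7k+k≡8k k) (+-monoʳ-< (7 * k) s<k)
    where
    7k+k≡8k : ∀ x → 7 * x + x ≡ 8 * x
    7k+k≡8k = solve-∀

  <k⇒2s+2k<8k : ∀ {s} → s < k → s + 2 * k + s < 8 * k
  <k⇒2s+2k<8k {s} s<k = <-≤-trans (+-mono-< (+-monoˡ-< (2 * k) s<k) s<k) 4k≤8k
    where
    4k≤8k : k + 2 * k + k ≤ 8 * k
    4k≤8k = subst (_≤ 8 * k) (4k≡k+2k+k k) (*-monoˡ-≤ k {4} {8} (s≤s (s≤s (s≤s (s≤s z≤n)))))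
      where
      4k≡k+2k+k : ∀ x → 4 * x ≡ x + 2 * x + x
      4k≡k+2k+k = solve-∀

  module Witnesses (r : ℕ) .{{_ : NonZero r}} (3L≤r : 3 * L ≤ r) where

    open Cyclic r

    L+L+L≤r : L + L + L ≤ r
    L+L+L≤r = subst (_≤ r) (3x≡x+x+x L) 3L≤r
      where
      3x≡x+x+x : ∀ x → 3 * x ≡ x + x + x
      3x≡x+x+x = solve-∀

    L+L≤r : L + L ≤ r
    L+L≤r = m+n≤o⇒m≤o (L + L) L+L+L≤r

    L≤r : L ≤ r
    L≤r = m+n≤o⇒m≤o L L+L≤r

    record Separators (d : ℕ) : Set where
      field
        T U : ℕ → ℕ
        T<r   : ∀ {s} → s < k → T s < r
        U<r   : ∀ {s} → s < k → U s < r
        U+d≈T : ∀ {s} → s < k → U s + d ≈ T s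
        φT≢φU : ∀ {s} → s < k → φ (T s) ≢ φ (U s)
        T-injective : ∀ {s s'} → T s ≡ T s' → s ≡ s'
        U-injective : ∀ {s s'} → U s ≡ U s' → s ≡ s'

    separators-small : ∀ {d} → 0 < d → d ≤ k → Separators d
    separators-small {d} 0<d d≤k = record
      { T = T ; U = U ; T<r = T<r ; U<r = λ {s} s<k → ≤-<-trans (U≤T s) (T<r s<k)
      ; U+d≈T = λ {s} _ → cong (_% r) (U+d≡T s)
      ; φT≢φU = λ s<k → subst₂ _≢_ (sym (φ-block-second (<k⇒<8k s<k)))
                                   (sym (φ-block-first k∸d<k (<k⇒<8k s<k))) (λ ())
      ; T-injective = λ eq → *-cancelʳ-≡ _ _ M (+-cancelˡ-≡ k _ _ eq)
      ; U-injective = λ eq → *-cancelʳ-≡ _ _ M (+-cancelˡ-≡ (k ∸ d) _ _ eq)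
      }
      where
      T U : ℕ → ℕ
      T s = k + s * M
      U s = (k ∸ d) + s * M

      T<r : ∀ {s} → s < k → T s < r
      T<r s<k = <-≤-trans (block<L k<M (<k⇒<8k s<k)) L≤r

      U≤T : ∀ s → U s ≤ T s
      U≤T s = +-monoˡ-≤ (s * M) (m∸n≤m k d)

      U+d≡T : ∀ s → U s + d ≡ T s
      U+d≡T s = trans (xy∙z≈xz∙y (k ∸ d) (s * M) d) (cong (_+ s * M) (m∸n+n≡m d≤k))

      k∸d<k : k ∸ d < k
      k∸d<k = ∸-monoʳ-< 0<d d≤k

    separators-large : ∀ {d} → k < d → L + d ≤ r → Separators d
    separators-large {d} k<d L+d≤r = record
      { T = λ s → s ; U = U ; T<r = T<r ; U<r = U<r
      ; U+d≈T = λ {s} _ → m+[r∸d]+d≈m s d≤r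
      ; φT≢φU = λ {s} s<k → subst₂ _≢_ (sym (φ-small s<k)) (sym (φ-outside (L≤U s))) (λ ())
      ; T-injective = λ eq → eq
      ; U-injective = λ eq → +-cancelʳ-≡ _ _ _ eq
      }
      where
      U : ℕ → ℕ
      U s = s + (r ∸ d)

      d≤r : d ≤ r
      d≤r = m+n≤o⇒n≤o L L+d≤r

      T<r : ∀ {s} → s < k → s < r
      T<r s<k = <-≤-trans (<-trans s<k k<d) d≤r

      U<r : ∀ {s} → s < k → U s < r
      U<r {s} s<k = subst (U s <_) (m+[n∸m]≡n d≤r) (+-monoˡ-< (r ∸ d) (<-trans s<k k<d))

      φ-small : ∀ {s} → s < k → φ s ≡ 1F
      φ-small {s} s<k =
        subst (λ t → φ t ≡ 1F) (+-identityʳ s) (φ-block-first s<k (<k⇒<8k (>-nonZero⁻¹ k)))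

      L≤U : ∀ s → L ≤ U s
      L≤U s = ≤-trans (m+n≤o⇒m≤o∸n L L+d≤r) (m≤n+m _ s)

    mirror : ∀ {d} → d ≤ r → Separators (r ∸ d) → Separators d
    mirror {d} d≤r S = record
      { T = U ; U = T ; T<r = U<r ; U<r = T<r
      ; U+d≈T = λ {s} s<k → trans (sym (+-congʳ-≈ d (U+d≈T s<k))) (m+[r∸d]+d≈m (U s) d≤r)
      ; φT≢φU = λ s<k → ≢-sym (φT≢φU s<k)
      ; T-injective = U-injective ; U-injective = T-injective
      }
      where open Separators S

    separators : ∀ {d} → 0 < d → d < r → Separators d
    separators {d} 0<d d<r with d ≤? k | L + d ≤? r
    ... | yes d≤k | _         = separators-small 0<d d≤k
    ... | no  d≰k | yes L+d≤r = separators-large (≰⇒> d≰k) L+d≤r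
    ... | no  _   | no  L+d≰r = mirror (<⇒≤ d<r) separators-reflected
      where
      e<L : r ∸ d < L
      e<L = m<n+o⇒m∸n<o r d (subst (r <_) (+-comm L d) (≰⇒> L+d≰r))
      separators-reflected : Separators (r ∸ d)
      separators-reflected with r ∸ d ≤? k
      ... | yes e≤k = separators-small (m<n⇒0<n∸m d<r) e≤k
      ... | no  e≰k = separators-large (≰⇒> e≰k) (≤-trans (<⇒≤ (+-monoʳ-< L e<L)) L+L≤r)

    record Triangles (c : ℕ) : Set where
      field
        α β γ : ℕ → ℕ
        α<r : ∀ {s} → s < k → α s < r
        β<r : ∀ {s} → s < k → β s < r
        γ<r : ∀ {s} → s < k → γ s < r
        γ+c≈α+β : ∀ {s} → s < k → γ s + c ≈ α s + β s
        α≢c : ∀ {s} → s < k → α s ≢ c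
        β≢c : ∀ {s} → s < k → β s ≢ c
        φα≢φγ : ∀ {s} → s < k → φ (α s) ≢ φ (γ s)
        φα≢φβ : ∀ {s} → s < k → φ (α s) ≢ φ (β s)
        φγ≢φβ : ∀ {s} → s < k → φ (γ s) ≢ φ (β s)
        α-injective : ∀ {s s'} → α s ≡ α s' → s ≡ s'
        β-injective : ∀ {s s'} → β s ≡ β s' → s ≡ s'

    module Outer where

      αₒ βₒ : ℕ → ℕ
      αₒ s = k + (7 * k + s) * M
      βₒ s = (7 * k + s) * M

      αₒ<L : ∀ {s} → s < k → αₒ s < L
      αₒ<L s<k = block<L k<M (<k⇒7k+<8k s<k)

      βₒ<L : ∀ {s} → s < k → βₒ s < L
      βₒ<L s<k = block<L (>-nonZero⁻¹ M) (<k⇒7k+<8k s<k)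

      αₒ+βₒ<L+L : ∀ {s} → s < k → αₒ s + βₒ s < L + L
      αₒ+βₒ<L+L s<k = +-mono-< (αₒ<L s<k) (βₒ<L s<k)

      φαₒ : ∀ {s} → s < k → φ (αₒ s) ≡ 2F
      φαₒ s<k = φ-block-second (<k⇒7k+<8k s<k)

      φβₒ : ∀ {s} → s < k → φ (βₒ s) ≡ 1F
      φβₒ s<k = φ-block-first (>-nonZero⁻¹ k) (<k⇒7k+<8k s<k)

      7kM≤βₒ : ∀ s → 7 * k * M ≤ βₒ s
      7kM≤βₒ s = *-monoˡ-≤ M (m≤m+n (7 * k) s)

      βₒ≤αₒ : ∀ s → βₒ s ≤ αₒ s
      βₒ≤αₒ s = m≤n+m (βₒ s) k

      6kM<βₒ : ∀ s → 6 * k * M < βₒ s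
      6kM<βₒ s = <-≤-trans (*-monoˡ-< M (m<n+m (6 * k) (>-nonZero⁻¹ k))) (7kM≤βₒ s)

      L+6kM≤αₒ+βₒ : ∀ s → L + 6 * k * M ≤ αₒ s + βₒ s
      L+6kM≤αₒ+βₒ s = subst (_≤ αₒ s + βₒ s) (14≡8+6 k M)
                        (+-mono-≤ (≤-trans (7kM≤βₒ s) (βₒ≤αₒ s)) (7kM≤βₒ s))
        where
        14≡8+6 : ∀ x y → 7 * x * y + 7 * x * y ≡ 8 * x * y + 6 * x * y
        14≡8+6 = solve-∀

      αₒ-injective : ∀ {s s'} → αₒ s ≡ αₒ s' → s ≡ s'
      αₒ-injective eq = +-cancelˡ-≡ (7 * k) _ _ (*-cancelʳ-≡ _ _ M (+-cancelˡ-≡ k _ _ eq))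

      βₒ-injective : ∀ {s s'} → βₒ s ≡ βₒ s' → s ≡ s'
      βₒ-injective eq = +-cancelˡ-≡ (7 * k) _ _ (*-cancelʳ-≡ _ _ M eq)

    open Outer

    triangles-low : ∀ {c} → c ≤ 6 * k * M → Triangles c
    triangles-low {c} c≤6kM = record
      { α = αₒ ; β = βₒ ; γ = γ
      ; α<r = λ s<k → <-≤-trans (αₒ<L s<k) L≤r
      ; β<r = λ s<k → <-≤-trans (βₒ<L s<k) L≤r
      ; γ<r = λ {s} s<k → ≤-<-trans (m∸n≤m _ c) (<-≤-trans (αₒ+βₒ<L+L s<k) L+L≤r)
      ; γ+c≈α+β = λ {s} _ → cong (_% r) (m∸n+n≡m (c≤αₒ+βₒ s))
      ; α≢c = λ {s} _ → >⇒≢ (<-≤-trans (c<βₒ s) (βₒ≤αₒ s))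
      ; β≢c = λ {s} _ → >⇒≢ (c<βₒ s)
      ; φα≢φγ = λ {s} s<k → subst₂ _≢_ (sym (φαₒ s<k)) (sym (φγ s)) (λ ())
      ; φα≢φβ = λ s<k → subst₂ _≢_ (sym (φαₒ s<k)) (sym (φβₒ s<k)) (λ ())
      ; φγ≢φβ = λ {s} s<k → subst₂ _≢_ (sym (φγ s)) (sym (φβₒ s<k)) (λ ())
      ; α-injective = αₒ-injective ; β-injective = βₒ-injective
      }
      where
      γ : ℕ → ℕ
      γ s = αₒ s + βₒ s ∸ c

      c<βₒ : ∀ s → c < βₒ s
      c<βₒ s = ≤-<-trans c≤6kM (6kM<βₒ s)

      c≤αₒ+βₒ : ∀ s → c ≤ αₒ s + βₒ s
      c≤αₒ+βₒ s = ≤-trans c≤6kM (≤-trans (m≤n+m _ L) (L+6kM≤αₒ+βₒ s))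

      φγ : ∀ s → φ (γ s) ≡ 0F
      φγ s = φ-outside (m+n≤o⇒m≤o∸n L (≤-trans (+-monoʳ-≤ L c≤6kM) (L+6kM≤αₒ+βₒ s)))

    triangles-high : ∀ {c} → L + L ≤ c → c < r → Triangles c
    triangles-high {c} L+L≤c c<r = record
      { α = αₒ ; β = βₒ ; γ = γ
      ; α<r = λ s<k → <-≤-trans (αₒ<L s<k) L≤r
      ; β<r = λ s<k → <-≤-trans (βₒ<L s<k) L≤r
      ; γ<r = λ {s} s<k → subst (γ s <_) (m+[n∸m]≡n (<⇒≤ c<r))
                                 (+-monoˡ-< (r ∸ c) (<-≤-trans (αₒ+βₒ<L+L s<k) L+L≤c))
      ; γ+c≈α+β = λ {s} _ → m+[r∸d]+d≈m (αₒ s + βₒ s) (<⇒≤ c<r)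
      ; α≢c = λ s<k → <⇒≢ (<-≤-trans (αₒ<L s<k) L≤c)
      ; β≢c = λ s<k → <⇒≢ (<-≤-trans (βₒ<L s<k) L≤c)
      ; φα≢φγ = λ {s} s<k → subst₂ _≢_ (sym (φαₒ s<k)) (sym (φγ s)) (λ ())
      ; φα≢φβ = λ s<k → subst₂ _≢_ (sym (φαₒ s<k)) (sym (φβₒ s<k)) (λ ())
      ; φγ≢φβ = λ {s} s<k → subst₂ _≢_ (sym (φγ s)) (sym (φβₒ s<k)) (λ ())
      ; α-injective = αₒ-injective ; β-injective = βₒ-injective
      }
      where
      γ : ℕ → ℕ
      γ s = αₒ s + βₒ s + (r ∸ c)

      L≤c : L ≤ c
      L≤c = m+n≤o⇒m≤o L L+L≤c

      φγ : ∀ s → φ (γ s) ≡ 0F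
      φγ s = φ-outside (≤-trans (m≤m+n L _) (≤-trans (L+6kM≤αₒ+βₒ s) (m≤m+n _ (r ∸ c))))

    triangles-middle : ∀ {c} → 6 * k * M < c → c < L + L → Triangles c
    triangles-middle {c} 6kM<c c<L+L = record
      { α = α ; β = β ; γ = γ
      ; α<r = λ s<k → <-≤-trans (+-mono-< c<L+L (m<L s<k)) L+L+L≤r
      ; β<r = λ s<k → <-≤-trans (block<L (>-nonZero⁻¹ M) (<k⇒<8k s<k)) L≤r
      ; γ<r = λ s<k → <-≤-trans (block<L k<M (<k⇒2s+2k<8k s<k)) L≤r
      ; γ+c≈α+β = λ {s} _ → cong (_% r) (rearrange k s c M)
      ; α≢c = λ {s} _ → >⇒≢ (m<m+n c (0<m s))
      ; β≢c = λ s<k → <⇒≢ (<-trans (β<kM s<k) (≤-<-trans (*-monoˡ-≤ M (m≤n*m k 6)) 6kM<c))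
      ; φα≢φγ = λ {s} s<k → subst₂ _≢_ (sym (φα s)) (sym (φγ s<k)) (λ ())
      ; φα≢φβ = λ {s} s<k → subst₂ _≢_ (sym (φα s)) (sym (φβ s<k)) (λ ())
      ; φγ≢φβ = λ s<k → subst₂ _≢_ (sym (φγ s<k)) (sym (φβ s<k)) (λ ())
      ; α-injective = λ eq → +-cancelʳ-≡ (2 * k) _ _
                               (*-cancelʳ-≡ _ _ M (+-cancelˡ-≡ k _ _ (+-cancelˡ-≡ c _ _ eq)))
      ; β-injective = λ eq → *-cancelʳ-≡ _ _ M eq
      }
      where
      m α β γ : ℕ → ℕ
      m s = k + (s + 2 * k) * M
      α s = c + m s
      β s = s * M
      γ s = k + (s + 2 * k + s) * M

      rearrange : ∀ a q b n → a + (q + 2 * a + q) * n + b ≡ b + (a + (q + 2 * a) * n) + q * n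
      rearrange = solve-∀

      m<L : ∀ {s} → s < k → m s < L
      m<L {s} s<k = block<L k<M (≤-<-trans (m≤m+n (s + 2 * k) s) (<k⇒2s+2k<8k s<k))

      0<m : ∀ s → 0 < m s
      0<m s = <-≤-trans (>-nonZero⁻¹ k) (m≤m+n k _)

      β<kM : ∀ {s} → s < k → β s < k * M
      β<kM s<k = *-monoˡ-< M s<k

      φα : ∀ s → φ (α s) ≡ 0F
      φα s = φ-outside (subst (_≤ α s) (6+2≡8 k M) (+-mono-≤ (<⇒≤ 6kM<c) 2kM≤m))
        where
        6+2≡8 : ∀ x y → 6 * x * y + 2 * x * y ≡ 8 * x * y
        6+2≡8 = solve-∀
        2kM≤m : 2 * k * M ≤ m s
        2kM≤m = ≤-trans (*-monoˡ-≤ M (m≤n+m (2 * k) s)) (m≤n+m _ k)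

      φβ : ∀ {s} → s < k → φ (β s) ≡ 1F
      φβ s<k = φ-block-first (>-nonZero⁻¹ k) (<k⇒<8k s<k)

      φγ : ∀ {s} → s < k → φ (γ s) ≡ 2F
      φγ s<k = φ-block-second (<k⇒2s+2k<8k s<k)

    triangles : ∀ {c} → c < r → Triangles c
    triangles {c} c<r with c ≤? 6 * k * M | c <? L + L
    ... | yes c≤6kM | _         = triangles-low c≤6kM
    ... | no  c≰6kM | yes c<L+L = triangles-middle (≰⇒> c≰6kM) c<L+L
    ... | no  _     | no  c≮L+L = triangles-high (≮⇒≥ c≮L+L) c<r

-- The colouring of K_{r,r}

injective-through : ∀ {A : Set} {m} {f : Fin m → A} (g : A → ℕ) {T : ℕ → ℕ} →
                    (∀ a → g (f a) ≡ T (toℕ a)) → (∀ {s s'} → T s ≡ T s' → s ≡ s') →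
                    Injective _≡_ _≡_ f
injective-through g {T} g∘f≡T T-injective {a} {b} fa≡fb =
  toℕ-injective (T-injective (trans (sym (g∘f≡T a)) (trans (cong g fa≡fb) (g∘f≡T b))))

module ThreeColouring (k' r : ℕ) .{{_ : NonZero r}} where

  k : ℕ
  k = suc k'

  open Pattern k
  open Cyclic r
  open Bipartite r

  colour : Fin (r + r) → Fin (r + r) → Fin 3
  colour u v with splitAt r u | splitAt r v
  ... | inj₁ i | inj₂ x = φ (δ i x)
  ... | inj₂ x | inj₁ i = φ (δ i x)
  ... | _      | _      = 0F    -- not an edge

  colour-sym : ∀ u v → colour u v ≡ colour v u
  colour-sym u v with splitAt r u | splitAt r v
  ... | inj₁ _ | inj₁ _ = refl
  ... | inj₁ _ | inj₂ _ = refl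
  ... | inj₂ _ | inj₁ _ = refl
  ... | inj₂ _ | inj₂ _ = refl

  colouring : EdgeColouring (Kbip r) 3
  colouring = record { col = colour ; colSym = λ {u} {v} _ → colour-sym u v }

  colour-left-right : ∀ i x → colour (left i) (right x) ≡ φ (δ i x)
  colour-left-right i x rewrite splitAt-↑ˡ r i r | splitAt-↑ʳ r r x = refl

  colour-right-left : ∀ x i → colour (right x) (left i) ≡ φ (δ i x)
  colour-right-left x i = trans (colour-sym (right x) (left i)) (colour-left-right i x)

  module _ (3L≤r : 3 * L ≤ r) where

    open Witnesses r 3L≤r

    left-left : ∀ {i j} → i ≢ j → HasKRainbowPaths (Kbip r) colouring k (left i) (left j)
    left-left {i} {j} i≢j =
      rainbow-paths-through-one (Kbip r) colouring (λ a → right (x a))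
        (λ eq → injective-through (δ i) δ-ix T-injective (right-injective eq)) path
      where
      open Separators (separators (n≢0⇒n>0 (δ≢0 i≢j)) (δ<r i j))

      x : Fin k → Fin r
      x a = i ⊕ T (toℕ a)

      δ-ix : ∀ a → δ i (x a) ≡ T (toℕ a)
      δ-ix a = δ-⊕ i (T<r (toℕ<n a))

      δ-jx : ∀ a → δ j (x a) ≡ U (toℕ a)
      δ-jx a = δ-unique (U<r (toℕ<n a)) (begin
        (toℕ j + U s) % r               ≡⟨ +-congʳ-≈ (U s) (δ-spec i j) ⟨
        (toℕ i + δ i j + U s) % r       ≡⟨ cong (_% r) (xy∙z≈x∙zy (toℕ i) _ (U s)) ⟩
        (toℕ i + (U s + δ i j)) % r     ≡⟨ +-congˡ-≈ (toℕ i) (U+d≈T (toℕ<n a)) ⟩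
        (toℕ i + T s) % r               ≡⟨ ⊕-spec i (T s) ⟨
        toℕ (x a) % r                   ∎)
        where
        open ≡-Reasoning
        s = toℕ a

      path : ∀ a → IsRainbowPath (Kbip r) colouring (left i) (left j) (right (x a) ∷ [])
      path a = rainbow-path₂ (Kbip r) colouring
        (left≢right i (x a)) (λ eq → i≢j (left-injective eq)) (right≢left (x a) j)
        (left-adj-right i (x a)) (right-adj-left (x a) j)
        (subst₂ _≢_ (sym (trans (colour-left-right i (x a)) (cong φ (δ-ix a))))
                    (sym (trans (colour-right-left (x a) j) (cong φ (δ-jx a))))
                    (φT≢φU (toℕ<n a)))

    right-right : ∀ {x x'} → x ≢ x' → HasKRainbowPaths (Kbip r) colouring k (right x) (right x')
    right-right {x} {x'} x≢x' =
      rainbow-paths-through-one (Kbip r) colouring (λ a → left (y a))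
        (λ eq → injective-through (λ z → δ z x') δ-yx' U-injective (left-injective eq)) path
      where
      open Separators (separators (n≢0⇒n>0 (δ≢0 (λ eq → x≢x' (sym eq)))) (δ<r x' x))

      y : Fin k → Fin r
      y a = x' ⊖ U (toℕ a)

      δ-yx' : ∀ a → δ (y a) x' ≡ U (toℕ a)
      δ-yx' a = δ-⊖ x' (U<r (toℕ<n a))

      δ-yx : ∀ a → δ (y a) x ≡ T (toℕ a)
      δ-yx a = δ-unique (T<r (toℕ<n a)) (begin
        (toℕ (y a) + T s) % r               ≡⟨ +-congˡ-≈ (toℕ (y a)) (U+d≈T (toℕ<n a)) ⟨
        (toℕ (y a) + (U s + δ x' x)) % r    ≡⟨ cong (_% r) (+-assoc (toℕ (y a)) (U s) _) ⟨
        (toℕ (y a) + U s + δ x' x) % r      ≡⟨ +-congʳ-≈ (δ x' x) (⊖-spec x' (<⇒≤ (U<r (toℕ<n a)))) ⟩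
        (toℕ x' + δ x' x) % r               ≡⟨ δ-spec x' x ⟩
        toℕ x % r                           ∎)
        where
        open ≡-Reasoning
        s = toℕ a

      path : ∀ a → IsRainbowPath (Kbip r) colouring (right x) (right x') (left (y a) ∷ [])
      path a = rainbow-path₂ (Kbip r) colouring
        (right≢left x (y a)) (λ eq → x≢x' (right-injective eq)) (left≢right (y a) x')
        (right-adj-left x (y a)) (left-adj-right (y a) x')
        (subst₂ _≢_ (sym (trans (colour-right-left x (y a)) (cong φ (δ-yx a))))
                    (sym (trans (colour-left-right (y a) x') (cong φ (δ-yx' a))))
                    (φT≢φU (toℕ<n a)))

    module OppositeSides (i j : Fin r) where

      open Triangles (triangles (δ<r i j)) public

      s<k : ∀ (a : Fin k') → toℕ a < k
      s<k a = m<n⇒m<1+n (toℕ<n a)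

      x y : Fin k' → Fin r
      x a = i ⊕ α (toℕ a)
      y a = j ⊖ β (toℕ a)

      δ-ix : ∀ a → δ i (x a) ≡ α (toℕ a)
      δ-ix a = δ-⊕ i (α<r (s<k a))

      δ-yj : ∀ a → δ (y a) j ≡ β (toℕ a)
      δ-yj a = δ-⊖ j (β<r (s<k a))

      δ-yx : ∀ a → δ (y a) (x a) ≡ γ (toℕ a)
      δ-yx a = δ-unique (γ<r (s<k a)) (+-cancelʳ-≈ c (begin
        (Y + γ s + c) % r       ≡⟨ cong (_% r) (+-assoc Y (γ s) c) ⟩
        (Y + (γ s + c)) % r     ≡⟨ +-congˡ-≈ Y (γ+c≈α+β (s<k a)) ⟩
        (Y + (α s + β s)) % r   ≡⟨ cong (_% r) (x∙yz≈xz∙y Y (α s) (β s)) ⟩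
        (Y + β s + α s) % r     ≡⟨ +-congʳ-≈ (α s) (⊖-spec j (<⇒≤ (β<r (s<k a)))) ⟩
        (toℕ j + α s) % r       ≡⟨ +-congʳ-≈ (α s) (δ-spec i j) ⟨
        (toℕ i + c + α s) % r   ≡⟨ cong (_% r) (xy∙z≈xz∙y (toℕ i) c (α s)) ⟩
        (toℕ i + α s + c) % r   ≡⟨ +-congʳ-≈ c (⊕-spec i (α s)) ⟨
        (toℕ (x a) + c) % r     ∎))
        where
        open ≡-Reasoning
        s = toℕ a
        c = δ i j
        Y = toℕ (y a)

      x-injective : Injective _≡_ _≡_ x
      x-injective = injective-through (δ i) δ-ix α-injective

      y-injective : Injective _≡_ _≡_ y
      y-injective = injective-through (λ z → δ z j) δ-yj β-injective

      x≢j : ∀ a → x a ≢ j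
      x≢j a eq = α≢c (s<k a) (trans (sym (δ-ix a)) (cong (δ i) eq))

      y≢i : ∀ a → y a ≢ i
      y≢i a eq = β≢c (s<k a) (trans (sym (δ-yj a)) (cong (λ z → δ z j) eq))

      colour-ix : ∀ a → colour (left i) (right (x a)) ≡ φ (α (toℕ a))
      colour-ix a = trans (colour-left-right i (x a)) (cong φ (δ-ix a))

      colour-yx : ∀ a → colour (left (y a)) (right (x a)) ≡ φ (γ (toℕ a))
      colour-yx a = trans (colour-left-right (y a) (x a)) (cong φ (δ-yx a))

      colour-yj : ∀ a → colour (left (y a)) (right j) ≡ φ (β (toℕ a))
      colour-yj a = trans (colour-left-right (y a) j) (cong φ (δ-yj a))

    left-right : ∀ i j → HasKRainbowPaths (Kbip r) colouring k (left i) (right j)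
    left-right i j = rainbow-paths-through-two (Kbip r) colouring (λ a → right (x a)) (λ a → left (y a))
      (λ eq → x-injective (right-injective eq)) (λ eq → y-injective (left-injective eq))
      (λ a b → right≢left (x a) (y b))
      (rainbow-edge (Kbip r) colouring (left≢right i j) (left-adj-right i j)) path
      where
      open OppositeSides i j

      path : ∀ a → IsRainbowPath (Kbip r) colouring (left i) (right j) (right (x a) ∷ left (y a) ∷ [])
      path a = rainbow-path₃ (Kbip r) colouring
        (left≢right i (x a)) (λ eq → y≢i a (sym (left-injective eq))) (left≢right i j)
        (right≢left (x a) (y a)) (λ eq → x≢j a (right-injective eq)) (left≢right (y a) j)
        (left-adj-right i (x a)) (right-adj-left (x a) (y a)) (left-adj-right (y a) j)
        (subst₂ _≢_ (sym (colour-ix a)) (sym colour-xy) (φα≢φγ (s<k a)))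
        (subst₂ _≢_ (sym (colour-ix a)) (sym (colour-yj a)) (φα≢φβ (s<k a)))
        (subst₂ _≢_ (sym colour-xy) (sym (colour-yj a)) (φγ≢φβ (s<k a)))
        where
        colour-xy : colour (right (x a)) (left (y a)) ≡ φ (γ (toℕ a))
        colour-xy = trans (colour-sym _ _) (colour-yx a)

    right-left : ∀ j i → HasKRainbowPaths (Kbip r) colouring k (right j) (left i)
    right-left j i = rainbow-paths-through-two (Kbip r) colouring (λ a → left (y a)) (λ a → right (x a))
      (λ eq → y-injective (left-injective eq)) (λ eq → x-injective (right-injective eq))
      (λ a b → left≢right (y a) (x b))
      (rainbow-edge (Kbip r) colouring (right≢left j i) (right-adj-left j i)) path
      where
      open OppositeSides i j

      path : ∀ a → IsRainbowPath (Kbip r) colouring (right j) (left i) (left (y a) ∷ right (x a) ∷ [])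
      path a = rainbow-path₃ (Kbip r) colouring
        (right≢left j (y a)) (λ eq → x≢j a (sym (right-injective eq))) (right≢left j i)
        (left≢right (y a) (x a)) (λ eq → y≢i a (left-injective eq)) (right≢left (x a) i)
        (right-adj-left j (y a)) (left-adj-right (y a) (x a)) (right-adj-left (x a) i)
        (subst₂ _≢_ (sym colour-jy) (sym (colour-yx a)) (≢-sym (φγ≢φβ (s<k a))))
        (subst₂ _≢_ (sym colour-jy) (sym colour-xi) (≢-sym (φα≢φβ (s<k a))))
        (subst₂ _≢_ (sym (colour-yx a)) (sym colour-xi) (≢-sym (φα≢φγ (s<k a))))
        where
        colour-jy : colour (right j) (left (y a)) ≡ φ (β (toℕ a))
        colour-jy = trans (colour-sym _ _) (colour-yj a)
        colour-xi : colour (right (x a)) (left i) ≡ φ (α (toℕ a))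
        colour-xi = trans (colour-sym _ _) (colour-ix a)

    rainbow-connected : RainbowKConnected (Kbip r) colouring k
    rainbow-connected u v u≢v with side-view u | side-view v
    ... | isLeft i  | isLeft j   = left-left (λ eq → u≢v (cong left eq))
    ... | isLeft i  | isRight x  = left-right i x
    ... | isRight x | isLeft i   = right-left x i
    ... | isRight x | isRight x' = right-right (λ eq → u≢v (cong right eq))

theorem2p4 : ∀ (k : ℕ) → 2 ≤ k → ∃[ g ] (∀ (r : ℕ) → g ≤ r → RcIs (Kbip r) k 3)
theorem2p4 (suc k') 2≤k = 3 * L , rc≡3
  where
  open Pattern (suc k') using (L)

  rc≡3 : ∀ r → 3 * L ≤ r → RcIs (Kbip r) (suc k') 3
  rc≡3 r 3L≤r =
    (colouring , rainbow-connected 3L≤r) , λ j j<3 c → fewer-than-three-colours j<3 c 2≤k vertex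
    where
    0<r : 0 < r
    0<r = <-≤-trans (>-nonZero⁻¹ (3 * L)) 3L≤r
    instance
      r-nonZero : NonZero r
      r-nonZero = >-nonZero 0<r
    open ThreeColouring k' r
    vertex : Fin r
    vertex = fromℕ< 0<r
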